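{- Let $a,b\ge1$ be integers. Then $$\sum_{\lambda \in \mathrm{P}(a,b)} q^{|\lambda|} t^{d(\lambda)} = \sum_{\lambda \in \mathrm{P}(a,b)} q^{|\lambda|_c} t^{\mathrm{cor}(\lambda)}.$$
   Context: A partition is a weakly decreasing finite sequence $\lambda=(\lambda_1\ge\dots\ge\lambda_\ell)$ of positive integers (the empty partition allowed), with Young diagram $D(\lambda)=\{(i,j): 1\le i\le \ell,\ 1\le j\le\lambda_i\}$ and area $|\lambda|=\sum_i\lambda_i$. $\mathrm{P}(a,b)$ is the set of partitions whose Young diagram lies inside $[a]\times[b]$ (i.e. at most $a$ parts, each at most $b$). The Durfee square size $d(\lambda)$ is the largest $k$ with $\lambda_k\ge k$ ($0$ if none). A cell $(i,j)\in D(\lambda)$ is a corner if $(i+1,j)\notin D(\lambda)$ and $(i,j+1)\notin D(\lambda)$; $\mathrm{Cor}(\lambda)$ is the set of corners and $\mathrm{cor}(\lambda)=|\mathrm{Cor}(\lambda)|$. The cohook area is $|\lambda|_c=\sum_{(i,j)\in\mathrm{Cor}(\lambda)}(i+j-1)$. Here $q,t$ are formal variables. -}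

module Defs where

open import Level using (Level)
open import Data.Bool using (Bool; true; false; _∧_; not)
open import Data.Nat using (ℕ; zero; suc; _+_; _∸_; _⊔_; _≤ᵇ_)
open import Data.Fin using (Fin; toℕ)
open import Data.Vec using (Vec; []; _∷_; toList)
import Data.Vec as Vec
open import Data.List using (List; []; _∷_; map; concatMap; filterᵇ; foldr; length; allFin; upTo)
open import Algebra.Bundles using (CommutativeSemiring)

-- A partition is represented by the list of its parts; zero parts are
-- allowed as padding (they do not change the Young diagram).

-- 1-indexed part: part ls i = λ_i, and 0 for i = 0 or i > length.
part : List ℕ → ℕ → ℕ
part []       _             = 0
part (x ∷ xs) zero          = 0
part (x ∷ xs) (suc zero)    = x
part (x ∷ xs) (suc (suc i)) = part xs (suc i)

decreasingᵇ : List ℕ → Bool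
decreasingᵇ []           = true
decreasingᵇ (x ∷ [])     = true
decreasingᵇ (x ∷ y ∷ xs) = (y ≤ᵇ x) ∧ decreasingᵇ (y ∷ xs)

inD : List ℕ → ℕ → ℕ → Bool
inD ls i j = (1 ≤ᵇ i) ∧ (1 ≤ᵇ j) ∧ (j ≤ᵇ part ls i)

data Cell : Set where
  cell : ℕ → ℕ → Cell

range1 : ℕ → List ℕ
range1 n = map suc (upTo n)

cells : List ℕ → List Cell
cells ls = concatMap (\ i → map (cell i) (range1 (part ls i))) (range1 (length ls))

isCorner : List ℕ → Cell → Bool
isCorner ls (cell i j) = inD ls i j ∧ not (inD ls (suc i) j) ∧ not (inD ls i (suc j))

corners : List ℕ → List Cell
corners ls = filterᵇ (isCorner ls) (cells ls)

area : List ℕ → ℕ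
area = foldr _+_ 0

durfee : List ℕ → ℕ
durfee ls = foldr _⊔_ 0 (filterᵇ (\ k → k ≤ᵇ part ls k) (range1 (length ls)))

cor : List ℕ → ℕ
cor ls = length (corners ls)

cohookArea : List ℕ → ℕ
cohookArea ls = foldr _+_ 0 (map (λ { (cell i j) → i + j ∸ 1 }) (corners ls))

allVecs : (a n : ℕ) → List (Vec (Fin n) a)
allVecs zero    n = [] ∷ []
allVecs (suc a) n = concatMap (λ x → map (x ∷_) (allVecs a n)) (allFin n)

-- P(a,b): partitions with at most a parts, each at most b, listed once each
-- as weakly decreasing length-a sequences with entries in {0,…,b}
P : ℕ → ℕ → List (List ℕ)
P a b = filterᵇ decreasingᵇ (map (λ v → toList (Vec.map toℕ v)) (allVecs a (suc b)))

module _ {c ℓ : Level} (R : CommutativeSemiring c ℓ) where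
  open CommutativeSemiring R using (Carrier; 0#) renaming (_+_ to _⊕_)
  Σ-list : {A : Set} → (A → Carrier) → List A → Carrier
  Σ-list f = foldr (λ x acc → f x ⊕ acc) 0#

-- Split a nonempty λ ∈ P(a,b) into its hook (first row of length c+1 and first column of
-- length r+1) and the partition μ ∈ P(r,c) left after removing it.  Then |λ| = |μ| + c + r + 1
-- and d(λ) = d(μ) + 1, so the left-hand side F(a,b) satisfies
--   F(a,b) = 1 + Σ_{r<a} Σ_{c<b} q^(c+r+1) t F(r,c),
-- which determines F.  The right-hand side satisfies the same recursion through a different
-- bijection μ ↦ λ onto the same set of λ: if μ has corners (i₁,j₁),…,(i_k,j_k) with i₁ < … < i_k,
-- let λ have corners (i₁,c+1),(i₂,j₁),…,(i_k,j_(k-1)),(r+1,j_k).  Every corner column moves down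
-- to the next corner row, so λ has one corner more than μ and |λ|_c = |μ|_c + c + r + 1.

module Submission where

open import Defs
open import Level using (Level)
open import Data.Nat using (ℕ; _≥_)
open import Algebra.Bundles using (CommutativeSemiring)
import Algebra.Definitions.RawSemiring as RS
import Relation.Binary.Reasoning.Setoid as SetoidReasoning

module PartitionStatistics where

  open import Data.Bool.Base using (Bool; true; false; T; not; _∧_; if_then_else_)
  open import Data.Bool.Properties using (∧-zeroʳ; ∧-identityʳ; T-≡)
  open import Data.Nat.Base using (zero; suc; _+_; _⊔_; _≤ᵇ_; _<ᵇ_; _≤_; _<_; z≤n; s≤s)
  open import Data.Nat.Properties
    using (≤⇒≤ᵇ; ≤ᵇ⇒≤; <⇒≱; ≤-refl; ≤-trans; ≰⇒>; ⊔-assoc; ⊔-identityʳ; +-identityʳ; +-assoc)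
  open import Data.List.Base
    using (List; []; _∷_; _++_; map; concatMap; filterᵇ; foldr; length; replicate; upTo; applyUpTo; allFin)
  open import Data.Fin.Base using (Fin; toℕ)
  open import Data.Vec.Base as Vec using (Vec; toList)
  open import Data.List.Properties
    using (filter-++; filter-none; map-++; map-∘; map-upTo; upTo-∷ʳ; concatMap-map; map-concatMap; concatMap-cong; length-map)
  open import Data.Nat.ListAction using (sum)
  open import Data.Nat.ListAction.Properties using (sum-++)
  open import Data.Nat.Tactic.RingSolver using (solve-∀)
  open import Data.List.Relation.Unary.All.Properties using (applyUpTo⁺₁)
  open import Data.List.Relation.Unary.Linked using (Linked; [-]; _∷_)
  open import Data.Unit.Base using (tt)
  open import Function.Base using (_∘_)
  open import Function.Bundles using (Equivalence)
  open import Relation.Nullary.Decidable.Core using (T?)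
  open import Relation.Nullary.Negation.Core using (¬_; contradiction)
  open import Relation.Binary.PropositionalEquality
    using (_≡_; _≢_; refl; sym; trans; cong; cong₂; subst; module ≡-Reasoning)

  filterᵇ-∷ : {A : Set} (p : A → Bool) (x : A) (xs : List A) →
              filterᵇ p (x ∷ xs) ≡ (if p x then x ∷ filterᵇ p xs else filterᵇ p xs)
  filterᵇ-∷ p x xs with p x
  ... | true  = refl
  ... | false = refl

  filterᵇ-map : {A B : Set} (p : B → Bool) (f : A → B) (xs : List A) →
                filterᵇ p (map f xs) ≡ map f (filterᵇ (p ∘ f) xs)
  filterᵇ-map p f []       = refl
  filterᵇ-map p f (x ∷ xs) with p (f x)
  ... | true  = cong (f x ∷_) (filterᵇ-map p f xs)
  ... | false = filterᵇ-map p f xs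

  filterᵇ-concatMap : {A B : Set} (p : B → Bool) (g : A → List B) (xs : List A) →
                      filterᵇ p (concatMap g xs) ≡ concatMap (filterᵇ p ∘ g) xs
  filterᵇ-concatMap p g []       = refl
  filterᵇ-concatMap p g (x ∷ xs) =
    trans (filter-++ (T? ∘ p) (g x) (concatMap g xs)) (cong (filterᵇ p (g x) ++_) (filterᵇ-concatMap p g xs))

  filterᵇ-false : {A : Set} (xs : List A) → filterᵇ (λ _ → false) xs ≡ []
  filterᵇ-false []       = refl
  filterᵇ-false (x ∷ xs) = filterᵇ-false xs

  length-as-sum : {A : Set} (xs : List A) → length xs ≡ sum (map (λ _ → 1) xs)
  length-as-sum []       = refl
  length-as-sum (x ∷ xs) = cong suc (length-as-sum xs)

  sum-map-suc : (xs : List ℕ) → sum (map suc xs) ≡ length xs + sum xs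
  sum-map-suc []       = refl
  sum-map-suc (x ∷ xs) = cong suc (trans (cong (x +_) (sum-map-suc xs)) (exchange x (length xs) (sum xs)))
    where
    exchange : ∀ a b c → a + (b + c) ≡ b + (a + c)
    exchange = solve-∀

  zeros : ℕ → List ℕ
  zeros n = replicate n 0

  sum-zeros : ∀ k → sum (zeros k) ≡ 0
  sum-zeros zero    = refl
  sum-zeros (suc k) = sum-zeros k

  1⊔-max-map-suc : ∀ ns → 1 ⊔ foldr _⊔_ 0 (map suc ns) ≡ suc (foldr _⊔_ 0 ns)
  1⊔-max-map-suc []       = refl
  1⊔-max-map-suc (n ∷ ns) = begin
    1 ⊔ (suc n ⊔ rest)       ≡⟨ ⊔-assoc 1 (suc n) rest ⟨
    suc n ⊔ rest             ≡⟨ cong (λ m → suc m ⊔ rest) (⊔-identityʳ n) ⟨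
    (suc n ⊔ 1) ⊔ rest       ≡⟨ ⊔-assoc (suc n) 1 rest ⟩
    suc n ⊔ (1 ⊔ rest)       ≡⟨ cong (suc n ⊔_) (1⊔-max-map-suc ns) ⟩
    suc n ⊔ suc (foldr _⊔_ 0 ns) ∎
    where
    open ≡-Reasoning
    rest = foldr _⊔_ 0 (map suc ns)

  ≤ᵇ-suc : ∀ m n → (suc m ≤ᵇ suc n) ≡ (m ≤ᵇ n)
  ≤ᵇ-suc zero    n = refl
  ≤ᵇ-suc (suc m) n = refl

  ≤ᵇ-true : ∀ {m n} → m ≤ n → (m ≤ᵇ n) ≡ true
  ≤ᵇ-true m≤n = Equivalence.to T-≡ (≤⇒≤ᵇ m≤n)

  ≤ᵇ-false : ∀ {m n} → n < m → (m ≤ᵇ n) ≡ false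
  ≤ᵇ-false {m} {n} n<m with m ≤ᵇ n in e
  ... | false = refl
  ... | true  = contradiction (≤ᵇ⇒≤ m n (subst T (sym e) tt)) (<⇒≱ n<m)

  range1-suc : ∀ n → range1 (suc n) ≡ 1 ∷ map suc (range1 n)
  range1-suc n = cong (1 ∷_) (cong (map suc) (sym (map-upTo suc n)))

  range1-∷ʳ : ∀ n → range1 (suc n) ≡ range1 n ++ suc n ∷ []
  range1-∷ʳ n = trans (cong (map suc) (sym (upTo-∷ʳ n))) (map-++ suc (upTo n) (n ∷ []))

  hook : ℕ → List ℕ → List ℕ
  hook c μ = suc c ∷ map suc μ

  -- Corners
  isCornerRow : ℕ → List ℕ → Bool
  isCornerRow x xs = not (x ≤ᵇ part xs 1)

  isCornerRow-< : ∀ x xs → part xs 1 < x → isCornerRow x xs ≡ true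
  isCornerRow-< x xs h<x = cong not (≤ᵇ-false h<x)

  isCornerRow-≥ : ∀ x xs → x ≤ part xs 1 → isCornerRow x xs ≡ false
  isCornerRow-≥ x xs x≤h = cong not (≤ᵇ-true x≤h)

  isCornerRow⇒< : ∀ x xs → isCornerRow x xs ≡ true → part xs 1 < x
  isCornerRow⇒< x xs eq = ≰⇒> (λ x≤h → true≢false (trans (sym eq) (isCornerRow-≥ x xs x≤h)))
    where
    true≢false : true ≢ false
    true≢false ()

  shiftRow : Cell → Cell
  shiftRow (cell i j) = cell (suc i) j

  rowCells : List ℕ → ℕ → List Cell
  rowCells ls i = map (cell i) (range1 (part ls i))

  rowCorners : List ℕ → ℕ → List Cell
  rowCorners ls = filterᵇ (isCorner ls) ∘ rowCells ls

  isCorner-beforeRowEnd : ∀ {k m} xs → k < m → isCorner (suc m ∷ xs) (cell 1 (suc k)) ≡ false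
  isCorner-beforeRowEnd {k} {m} xs k<m with k <ᵇ m | ≤ᵇ-true k<m
  ... | true | _ = trans (cong (inD (suc m ∷ xs) 1 (suc k) ∧_) (∧-zeroʳ _)) (∧-zeroʳ _)

  isCorner-rowEnd : ∀ m xs → isCorner (suc m ∷ xs) (cell 1 (suc m)) ≡ isCornerRow (suc m) xs
  isCorner-rowEnd m xs with m <ᵇ suc m | ≤ᵇ-true (≤-refl {suc m}) | m <ᵇ m | ≤ᵇ-false {suc m} {m} ≤-refl
  ... | true | _ | false | _ = ∧-identityʳ _

  firstRow-corners : ∀ x xs → rowCorners (x ∷ xs) 1 ≡ (if isCornerRow x xs then cell 1 x ∷ [] else [])
  firstRow-corners zero    xs = refl
  firstRow-corners (suc m) xs = begin
    filterᵇ C? (map (cell 1) (range1 (suc m)))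
      ≡⟨ cong (filterᵇ C? ∘ map (cell 1)) (range1-∷ʳ m) ⟩
    filterᵇ C? (map (cell 1) (range1 m ++ suc m ∷ []))
      ≡⟨ cong (filterᵇ C?) (map-++ (cell 1) (range1 m) (suc m ∷ [])) ⟩
    filterᵇ C? (map (cell 1) (range1 m) ++ cell 1 (suc m) ∷ [])
      ≡⟨ filter-++ (T? ∘ C?) (map (cell 1) (range1 m)) (cell 1 (suc m) ∷ []) ⟩
    filterᵇ C? (map (cell 1) (range1 m)) ++ filterᵇ C? (cell 1 (suc m) ∷ [])
      ≡⟨ cong₂ _++_ interior (filterᵇ-∷ C? (cell 1 (suc m)) []) ⟩
    (if C? (cell 1 (suc m)) then cell 1 (suc m) ∷ [] else [])
      ≡⟨ cong (λ b → if b then cell 1 (suc m) ∷ [] else []) (isCorner-rowEnd m xs) ⟩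
    (if isCornerRow (suc m) xs then cell 1 (suc m) ∷ [] else []) ∎
    where
    open ≡-Reasoning
    C? : Cell → Bool
    C? = isCorner (suc m ∷ xs)
    interior : filterᵇ C? (map (cell 1) (range1 m)) ≡ []
    interior = begin
      filterᵇ C? (map (cell 1) (map suc (upTo m)))
        ≡⟨ filterᵇ-map C? (cell 1) (map suc (upTo m)) ⟩
      map (cell 1) (filterᵇ (C? ∘ cell 1) (map suc (upTo m)))
        ≡⟨ cong (map (cell 1)) (filterᵇ-map (C? ∘ cell 1) suc (upTo m)) ⟩
      map (cell 1) (map suc (filterᵇ (C? ∘ cell 1 ∘ suc) (upTo m)))
        ≡⟨ cong (map (cell 1) ∘ map suc)
                (filter-none (T? ∘ C? ∘ cell 1 ∘ suc) (applyUpTo⁺₁ _ m notCorner)) ⟩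
      [] ∎
      where
      notCorner : ∀ {k} → k < m → ¬ T (C? (cell 1 (suc k)))
      notCorner k<m = subst (¬_ ∘ T) (sym (isCorner-beforeRowEnd xs k<m)) (λ ())

  corners-by-rows : ∀ ls → corners ls ≡ concatMap (rowCorners ls) (range1 (length ls))
  corners-by-rows ls = filterᵇ-concatMap (isCorner ls) (rowCells ls) (range1 (length ls))

  rowCorners-shift : ∀ x xs k → rowCorners (x ∷ xs) (suc (suc k)) ≡ map shiftRow (rowCorners xs (suc k))
  rowCorners-shift x xs k = begin
    filterᵇ (isCorner (x ∷ xs)) (map (cell (suc (suc k))) row)
      ≡⟨ filterᵇ-map (isCorner (x ∷ xs)) (cell (suc (suc k))) row ⟩
    map (shiftRow ∘ cell (suc k)) (filterᵇ (isCorner xs ∘ cell (suc k)) row)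
      ≡⟨ map-∘ (filterᵇ (isCorner xs ∘ cell (suc k)) row) ⟩
    map shiftRow (map (cell (suc k)) (filterᵇ (isCorner xs ∘ cell (suc k)) row))
      ≡⟨ cong (map shiftRow) (filterᵇ-map (isCorner xs) (cell (suc k)) row) ⟨
    map shiftRow (rowCorners xs (suc k)) ∎
    where
    open ≡-Reasoning
    row = range1 (part xs (suc k))

  corners-∷ : ∀ x xs →
              corners (x ∷ xs) ≡ (if isCornerRow x xs then cell 1 x ∷ [] else []) ++ map shiftRow (corners xs)
  corners-∷ x xs = begin
    corners (x ∷ xs)
      ≡⟨ corners-by-rows (x ∷ xs) ⟩
    concatMap (rowCorners (x ∷ xs)) (range1 (suc n))
      ≡⟨ cong (concatMap (rowCorners (x ∷ xs))) (range1-suc n) ⟩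
    rowCorners (x ∷ xs) 1 ++ concatMap (rowCorners (x ∷ xs)) (map suc (map suc (upTo n)))
      ≡⟨ cong₂ _++_ (firstRow-corners x xs) lowerRows ⟩
    (if isCornerRow x xs then cell 1 x ∷ [] else []) ++ map shiftRow (corners xs) ∎
    where
    open ≡-Reasoning
    n = length xs
    lowerRows : concatMap (rowCorners (x ∷ xs)) (map suc (map suc (upTo n))) ≡ map shiftRow (corners xs)
    lowerRows = begin
      concatMap (rowCorners (x ∷ xs)) (map suc (map suc (upTo n)))
        ≡⟨ concatMap-map (rowCorners (x ∷ xs)) suc (map suc (upTo n)) ⟩
      concatMap (rowCorners (x ∷ xs) ∘ suc) (map suc (upTo n))
        ≡⟨ concatMap-map (rowCorners (x ∷ xs) ∘ suc) suc (upTo n) ⟩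
      concatMap (rowCorners (x ∷ xs) ∘ suc ∘ suc) (upTo n)
        ≡⟨ concatMap-cong (rowCorners-shift x xs) (upTo n) ⟩
      concatMap (map shiftRow ∘ rowCorners xs ∘ suc) (upTo n)
        ≡⟨ map-concatMap shiftRow (rowCorners xs ∘ suc) (upTo n) ⟨
      map shiftRow (concatMap (rowCorners xs ∘ suc) (upTo n))
        ≡⟨ cong (map shiftRow) (concatMap-map (rowCorners xs) suc (upTo n)) ⟨
      map shiftRow (concatMap (rowCorners xs) (range1 n))
        ≡⟨ cong (map shiftRow) (corners-by-rows xs) ⟨
      map shiftRow (corners xs) ∎

  part1-++-zeros : ∀ l k → part (l ++ zeros k) 1 ≡ part l 1
  part1-++-zeros []      zero    = refl
  part1-++-zeros []      (suc k) = refl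
  part1-++-zeros (x ∷ l) k       = refl

  corners-++-zeros : ∀ l k → corners (l ++ zeros k) ≡ corners l
  corners-++-zeros []      zero    = refl
  corners-++-zeros []      (suc k) = trans (corners-∷ 0 (zeros k)) (cong (map shiftRow) (corners-++-zeros [] k))
  corners-++-zeros (x ∷ l) k       = begin
    corners (x ∷ (l ++ zeros k))
      ≡⟨ corners-∷ x (l ++ zeros k) ⟩
    firstRow (part (l ++ zeros k) 1) ++ map shiftRow (corners (l ++ zeros k))
      ≡⟨ cong₂ _++_ (cong firstRow (part1-++-zeros l k)) (cong (map shiftRow) (corners-++-zeros l k)) ⟩
    firstRow (part l 1) ++ map shiftRow (corners l)
      ≡⟨ corners-∷ x l ⟨
    corners (x ∷ l) ∎
    where
    open ≡-Reasoning
    firstRow : ℕ → List Cell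
    firstRow h = if not (x ≤ᵇ h) then cell 1 x ∷ [] else []

  cornerSum : (Cell → ℕ) → List ℕ → ℕ
  cornerSum h ls = sum (map h (corners ls))

  cornerSum-∷ : ∀ h x xs →
                cornerSum h (x ∷ xs) ≡ (if isCornerRow x xs then h (cell 1 x) else 0) + cornerSum (h ∘ shiftRow) xs
  cornerSum-∷ h x xs = begin
    sum (map h (corners (x ∷ xs)))
      ≡⟨ cong (sum ∘ map h) (corners-∷ x xs) ⟩
    sum (map h (firstRow ++ map shiftRow (corners xs)))
      ≡⟨ cong sum (map-++ h firstRow (map shiftRow (corners xs))) ⟩
    sum (map h firstRow ++ map h (map shiftRow (corners xs)))
      ≡⟨ sum-++ (map h firstRow) (map h (map shiftRow (corners xs))) ⟩
    sum (map h firstRow) + sum (map h (map shiftRow (corners xs)))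
      ≡⟨ cong₂ _+_ (firstRow-sum (isCornerRow x xs)) (cong sum (map-∘ (corners xs))) ⟨
    (if isCornerRow x xs then h (cell 1 x) else 0) + cornerSum (h ∘ shiftRow) xs ∎
    where
    open ≡-Reasoning
    firstRow = if isCornerRow x xs then cell 1 x ∷ [] else []
    firstRow-sum : ∀ b → (if b then h (cell 1 x) else 0) ≡ sum (map h (if b then cell 1 x ∷ [] else []))
    firstRow-sum true  = sym (+-identityʳ (h (cell 1 x)))
    firstRow-sum false = refl

  -- Corners lie in rows ≥ 1, so agreement there suffices; this is what lets the cohook weight
  -- i + j ∸ 1, with its truncated subtraction, be shifted by a row.
  cornerSum-cong : ∀ {h h′ : Cell → ℕ} → (∀ i j → h (cell (suc i) j) ≡ h′ (cell (suc i) j)) →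
                   ∀ ls → cornerSum h ls ≡ cornerSum h′ ls
  cornerSum-cong           eq []       = refl
  cornerSum-cong {h} {h′} eq (x ∷ xs) = begin
    cornerSum h (x ∷ xs)
      ≡⟨ cornerSum-∷ h x xs ⟩
    (if isCornerRow x xs then h (cell 1 x) else 0) + cornerSum (h ∘ shiftRow) xs
      ≡⟨ cong₂ _+_ (cong (λ v → if isCornerRow x xs then v else 0) (eq 0 x))
                   (cornerSum-cong (λ i j → eq (suc i) j) xs) ⟩
    (if isCornerRow x xs then h′ (cell 1 x) else 0) + cornerSum (h′ ∘ shiftRow) xs
      ≡⟨ cornerSum-∷ h′ x xs ⟨
    cornerSum h′ (x ∷ xs) ∎
    where open ≡-Reasoning

  cornerSum-suc : ∀ h ls → cornerSum (suc ∘ h) ls ≡ cor ls + cornerSum h ls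
  cornerSum-suc h ls = begin
    sum (map (suc ∘ h) (corners ls))
      ≡⟨ cong sum (map-∘ (corners ls)) ⟩
    sum (map suc (map h (corners ls)))
      ≡⟨ sum-map-suc (map h (corners ls)) ⟩
    length (map h (corners ls)) + cornerSum h ls
      ≡⟨ cong (_+ cornerSum h ls) (length-map h (corners ls)) ⟩
    cor ls + cornerSum h ls ∎
    where open ≡-Reasoning

  cor-∷ : ∀ x xs → cor (x ∷ xs) ≡ (if isCornerRow x xs then 1 else 0) + cor xs
  cor-∷ x xs = trans (length-as-sum (corners (x ∷ xs)))
                     (trans (cornerSum-∷ _ x xs) (cong ((if isCornerRow x xs then 1 else 0) +_)
                                                       (sym (length-as-sum (corners xs)))))

  cohookArea-∷ : ∀ x xs → cohookArea (x ∷ xs) ≡ (if isCornerRow x xs then x else 0) + (cor xs + cohookArea xs)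
  cohookArea-∷ x xs =
    trans (cornerSum-∷ _ x xs) (cong ((if isCornerRow x xs then x else 0) +_)
                                    (trans (cornerSum-cong (λ i j → refl) xs) (cornerSum-suc _ xs)))

  cor-∷-corner : ∀ x xs → isCornerRow x xs ≡ true → cor (x ∷ xs) ≡ suc (cor xs)
  cor-∷-corner x xs eq = trans (cor-∷ x xs) (cong (λ b → (if b then 1 else 0) + cor xs) eq)

  cor-∷-notCorner : ∀ x xs → isCornerRow x xs ≡ false → cor (x ∷ xs) ≡ cor xs
  cor-∷-notCorner x xs eq = trans (cor-∷ x xs) (cong (λ b → (if b then 1 else 0) + cor xs) eq)

  cohookArea-∷-corner : ∀ x xs → isCornerRow x xs ≡ true →
                        cohookArea (x ∷ xs) ≡ x + (cor xs + cohookArea xs)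
  cohookArea-∷-corner x xs eq =
    trans (cohookArea-∷ x xs) (cong (λ b → (if b then x else 0) + (cor xs + cohookArea xs)) eq)

  cohookArea-∷-notCorner : ∀ x xs → isCornerRow x xs ≡ false →
                           cohookArea (x ∷ xs) ≡ cor xs + cohookArea xs
  cohookArea-∷-notCorner x xs eq =
    trans (cohookArea-∷ x xs) (cong (λ b → (if b then x else 0) + (cor xs + cohookArea xs)) eq)

  cor-++-zeros : ∀ l k → cor (l ++ zeros k) ≡ cor l
  cor-++-zeros l k = cong length (corners-++-zeros l k)

  cohookArea-++-zeros : ∀ l k → cohookArea (l ++ zeros k) ≡ cohookArea l
  cohookArea-++-zeros l k = cong (sum ∘ map _) (corners-++-zeros l k)

  -- Area and Durfee square
  area-++-zeros : ∀ l k → area (l ++ zeros k) ≡ area l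
  area-++-zeros l k = trans (sum-++ l (zeros k)) (trans (cong (area l +_) (sum-zeros k)) (+-identityʳ (area l)))

  area-hook : ∀ c μ → area (hook c μ) ≡ suc c + length μ + area μ
  area-hook c μ = trans (cong (suc c +_) (sum-map-suc μ)) (sym (+-assoc (suc c) (length μ) (area μ)))

  durfeeRows : (ℕ → ℕ) → List ℕ → List ℕ
  durfeeRows f ls = filterᵇ (λ i → f i ≤ᵇ part ls (suc i)) (upTo (length ls))

  durfee-rows : ∀ ls → durfee ls ≡ foldr _⊔_ 0 (map suc (durfeeRows suc ls))
  durfee-rows ls = cong (foldr _⊔_ 0) (filterᵇ-map (λ k → k ≤ᵇ part ls k) suc (upTo (length ls)))

  durfeeRows-∷ : ∀ f x xs → durfeeRows f (x ∷ xs) ≡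
                 (if f 0 ≤ᵇ x then 0 ∷ map suc (durfeeRows (f ∘ suc) xs) else map suc (durfeeRows (f ∘ suc) xs))
  durfeeRows-∷ f x xs = begin
    filterᵇ p (0 ∷ applyUpTo suc (length xs))
      ≡⟨ cong (filterᵇ p ∘ (0 ∷_)) (map-upTo suc (length xs)) ⟨
    filterᵇ p (0 ∷ map suc (upTo (length xs)))
      ≡⟨ filterᵇ-∷ p 0 (map suc (upTo (length xs))) ⟩
    (if p 0 then 0 ∷ filterᵇ p (map suc (upTo (length xs))) else filterᵇ p (map suc (upTo (length xs))))
      ≡⟨ cong (λ r → if p 0 then 0 ∷ r else r) (filterᵇ-map p suc (upTo (length xs))) ⟩
    (if f 0 ≤ᵇ x then 0 ∷ map suc (durfeeRows (f ∘ suc) xs) else map suc (durfeeRows (f ∘ suc) xs)) ∎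
    where
    open ≡-Reasoning
    p : ℕ → Bool
    p i = f i ≤ᵇ part (x ∷ xs) (suc i)

  durfeeRows-++-zeros : ∀ (g : ℕ → ℕ) l k → durfeeRows (suc ∘ g) (l ++ zeros k) ≡ durfeeRows (suc ∘ g) l
  durfeeRows-++-zeros g []      zero    = refl
  durfeeRows-++-zeros g []      (suc k) =
    trans (durfeeRows-∷ (suc ∘ g) 0 (zeros k)) (cong (map suc) (durfeeRows-++-zeros (g ∘ suc) [] k))
  durfeeRows-++-zeros g (x ∷ l) k       = begin
    durfeeRows (suc ∘ g) (x ∷ (l ++ zeros k))
      ≡⟨ durfeeRows-∷ (suc ∘ g) x (l ++ zeros k) ⟩
    withFirstRow (map suc (durfeeRows (suc ∘ g ∘ suc) (l ++ zeros k)))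
      ≡⟨ cong (withFirstRow ∘ map suc) (durfeeRows-++-zeros (g ∘ suc) l k) ⟩
    withFirstRow (map suc (durfeeRows (suc ∘ g ∘ suc) l))
      ≡⟨ durfeeRows-∷ (suc ∘ g) x l ⟨
    durfeeRows (suc ∘ g) (x ∷ l) ∎
    where
    open ≡-Reasoning
    withFirstRow : List ℕ → List ℕ
    withFirstRow r = if suc (g 0) ≤ᵇ x then 0 ∷ r else r

  durfeeRows-map-suc : ∀ f μ → durfeeRows (suc ∘ f) (map suc μ) ≡ durfeeRows f μ
  durfeeRows-map-suc f []      = refl
  durfeeRows-map-suc f (y ∷ μ) = begin
    durfeeRows (suc ∘ f) (suc y ∷ map suc μ)
      ≡⟨ durfeeRows-∷ (suc ∘ f) (suc y) (map suc μ) ⟩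
    withFirstRow (suc (f 0) ≤ᵇ suc y) (map suc (durfeeRows (suc ∘ f ∘ suc) (map suc μ)))
      ≡⟨ cong₂ withFirstRow (≤ᵇ-suc (f 0) y) (cong (map suc) (durfeeRows-map-suc (f ∘ suc) μ)) ⟩
    withFirstRow (f 0 ≤ᵇ y) (map suc (durfeeRows (f ∘ suc) μ))
      ≡⟨ durfeeRows-∷ f y μ ⟨
    durfeeRows f (y ∷ μ) ∎
    where
    open ≡-Reasoning
    withFirstRow : Bool → List ℕ → List ℕ
    withFirstRow b r = if b then 0 ∷ r else r

  durfee-++-zeros : ∀ l k → durfee (l ++ zeros k) ≡ durfee l
  durfee-++-zeros l k = begin
    durfee (l ++ zeros k)
      ≡⟨ durfee-rows (l ++ zeros k) ⟩
    foldr _⊔_ 0 (map suc (durfeeRows suc (l ++ zeros k)))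
      ≡⟨ cong (foldr _⊔_ 0 ∘ map suc) (durfeeRows-++-zeros (λ i → i) l k) ⟩
    foldr _⊔_ 0 (map suc (durfeeRows suc l))
      ≡⟨ durfee-rows l ⟨
    durfee l ∎
    where open ≡-Reasoning

  durfee-hook : ∀ c μ → durfee (hook c μ) ≡ suc (durfee μ)
  durfee-hook c μ = begin
    durfee (hook c μ)
      ≡⟨ durfee-rows (hook c μ) ⟩
    foldr _⊔_ 0 (map suc (durfeeRows suc (hook c μ)))
      ≡⟨ cong (foldr _⊔_ 0 ∘ map suc) (durfeeRows-∷ suc (suc c) (map suc μ)) ⟩
    1 ⊔ foldr _⊔_ 0 (map suc (map suc (durfeeRows (suc ∘ suc) (map suc μ))))
      ≡⟨ cong (λ r → 1 ⊔ foldr _⊔_ 0 (map suc (map suc r))) (durfeeRows-map-suc suc μ) ⟩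
    1 ⊔ foldr _⊔_ 0 (map suc (map suc (durfeeRows suc μ)))
      ≡⟨ 1⊔-max-map-suc (map suc (durfeeRows suc μ)) ⟩
    suc (foldr _⊔_ 0 (map suc (durfeeRows suc μ)))
      ≡⟨ cong suc (durfee-rows μ) ⟨
    suc (durfee μ) ∎
    where open ≡-Reasoning

  -- Shifting corners
  head-≤ : ∀ {b μ} → Linked _≥_ (b ∷ μ) → part μ 1 ≤ b
  head-≤ [-]       = z≤n
  head-≤ (b≥y ∷ _) = b≥y

  rebound : ∀ {a b μ} → part μ 1 ≤ b → Linked _≥_ (a ∷ μ) → Linked _≥_ (b ∷ μ)
  rebound h≤b [-]      = [-]
  rebound h≤b (_ ∷ μ↓) = h≤b ∷ μ↓

  -- Row k+1 of expand X μ is as long as the last corner row of μ among rows 1…k, or X if there is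
  -- none; for X = c+1 this is the corner-shifting bijection of the header.
  expand : ℕ → List ℕ → List ℕ
  expand X []      = X ∷ []
  expand X (y ∷ μ) = X ∷ expand (if isCornerRow y μ then y else X) μ

  expand-cornerRow : ∀ {X Z} μ → X < Z → isCornerRow Z (expand X μ) ≡ true
  expand-cornerRow {X} []      X<Z = isCornerRow-< _ (X ∷ []) X<Z
  expand-cornerRow (y ∷ μ) X<Z = isCornerRow-< _ (expand _ (y ∷ μ)) X<Z

  expand-notCornerRow : ∀ X μ → isCornerRow X (expand X μ) ≡ false
  expand-notCornerRow X []      = isCornerRow-≥ X (X ∷ []) ≤-refl
  expand-notCornerRow X (y ∷ μ) = isCornerRow-≥ X (expand X (y ∷ μ)) ≤-refl

  cor-expand : ∀ {c μ} → Linked _≥_ (c ∷ μ) → cor (expand (suc c) μ) ≡ suc (cor μ)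
  cor-expand {c} {[]}    _          = cor-∷-corner (suc c) [] refl
  cor-expand {c} {y ∷ μ} (y≤c ∷ μ↓) with isCornerRow y μ in eq
  ... | true with isCornerRow⇒< y μ eq
  ...   | s≤s h≤y′ = begin
    cor (suc c ∷ expand y μ)
      ≡⟨ cor-∷-corner (suc c) (expand y μ) (expand-cornerRow μ (s≤s y≤c)) ⟩
    suc (cor (expand y μ))
      ≡⟨ cong suc (cor-expand (rebound h≤y′ μ↓)) ⟩
    suc (suc (cor μ))
      ≡⟨ cong suc (cor-∷-corner y μ eq) ⟨
    suc (cor (y ∷ μ)) ∎
    where open ≡-Reasoning
  cor-expand {c} {y ∷ μ} (y≤c ∷ μ↓) | false = begin
    cor (suc c ∷ expand (suc c) μ)
      ≡⟨ cor-∷-notCorner (suc c) (expand (suc c) μ) (expand-notCornerRow (suc c) μ) ⟩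
    cor (expand (suc c) μ)
      ≡⟨ cor-expand (rebound (≤-trans (head-≤ μ↓) y≤c) μ↓) ⟩
    suc (cor μ)
      ≡⟨ cong suc (cor-∷-notCorner y μ eq) ⟨
    suc (cor (y ∷ μ)) ∎
    where open ≡-Reasoning

  cohookArea-expand : ∀ {c μ} → Linked _≥_ (c ∷ μ) →
                      cohookArea (expand (suc c) μ) ≡ suc c + length μ + cohookArea μ
  cohookArea-expand {c} {[]}    _          = trans (cohookArea-∷-corner (suc c) [] refl) (sym (+-assoc (suc c) 0 0))
  cohookArea-expand {c} {y ∷ μ} (y≤c ∷ μ↓) with isCornerRow y μ in eq
  ... | true with isCornerRow⇒< y μ eq
  ...   | s≤s h≤y′ = begin
    cohookArea (suc c ∷ expand y μ)
      ≡⟨ cohookArea-∷-corner (suc c) (expand y μ) (expand-cornerRow μ (s≤s y≤c)) ⟩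
    suc c + (cor (expand y μ) + cohookArea (expand y μ))
      ≡⟨ cong (suc c +_) (cong₂ _+_ (cor-expand μ↓′) (cohookArea-expand μ↓′)) ⟩
    suc c + (suc (cor μ) + (y + length μ + cohookArea μ))
      ≡⟨ rearrange (suc c) y (length μ) (cor μ) (cohookArea μ) ⟩
    suc c + suc (length μ) + (y + (cor μ + cohookArea μ))
      ≡⟨ cong (suc c + suc (length μ) +_) (cohookArea-∷-corner y μ eq) ⟨
    suc c + length (y ∷ μ) + cohookArea (y ∷ μ) ∎
    where
    open ≡-Reasoning
    μ↓′ = rebound h≤y′ μ↓
    rearrange : ∀ c y l k a → c + (suc k + (y + l + a)) ≡ c + suc l + (y + (k + a))
    rearrange = solve-∀
  cohookArea-expand {c} {y ∷ μ} (y≤c ∷ μ↓) | false = begin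
    cohookArea (suc c ∷ expand (suc c) μ)
      ≡⟨ cohookArea-∷-notCorner (suc c) (expand (suc c) μ) (expand-notCornerRow (suc c) μ) ⟩
    cor (expand (suc c) μ) + cohookArea (expand (suc c) μ)
      ≡⟨ cong₂ _+_ (cor-expand μ↓′) (cohookArea-expand μ↓′) ⟩
    suc (cor μ) + (suc c + length μ + cohookArea μ)
      ≡⟨ rearrange (suc c) (length μ) (cor μ) (cohookArea μ) ⟩
    suc c + suc (length μ) + (cor μ + cohookArea μ)
      ≡⟨ cong (suc c + suc (length μ) +_) (cohookArea-∷-notCorner y μ eq) ⟨
    suc c + length (y ∷ μ) + cohookArea (y ∷ μ) ∎
    where
    open ≡-Reasoning
    μ↓′ = rebound (≤-trans (head-≤ μ↓) y≤c) μ↓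
    rearrange : ∀ c l k a → suc k + (c + l + a) ≡ c + suc l + (k + a)
    rearrange = solve-∀

  sequences : ℕ → ℕ → List (List ℕ)
  sequences m k = map (λ v → toList (Vec.map toℕ v)) (allVecs m k)

  sequences-suc : ∀ m k → sequences (suc m) k ≡ concatMap (λ y → map (toℕ y ∷_) (sequences m k)) (allFin k)
  sequences-suc m k =
    trans (map-concatMap toSeq (λ y → map (y Vec.∷_) (allVecs m k)) (allFin k))
          (concatMap-cong (λ y → trans (sym (map-∘ (allVecs m k))) (map-∘ (allVecs m k))) (allFin k))
    where
    toSeq : ∀ {m} → Vec (Fin k) m → List ℕ
    toSeq v = toList (Vec.map toℕ v)

module GeneratingFunctions {c ℓ : Level} (R : CommutativeSemiring c ℓ) where
  open import Data.Bool.Base using (Bool; true; false; _∧_; if_then_else_)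
  open import Data.List.Relation.Unary.Linked using (Linked; [-]; _∷_)
  open import Data.Nat.Base as ℕ using (zero; suc; _∸_; _≤_; _<_; _≤ᵇ_; s≤s)
  open import Data.Nat.Properties using (≤-refl; m≤n⇒m<n∨m≡n)
  open import Data.Fin.Base as Fin using (Fin; toℕ)
  open import Data.Fin.Properties using (toℕ-inject₁; toℕ-fromℕ; toℕ<n; toℕ≤pred[n])
  open import Data.Nat.Induction using (<-rec)
  open import Data.List.Base using (List; []; _∷_; _++_; map; concatMap; filterᵇ; length; tabulate; allFin)
  open import Data.List.Properties using (foldr-map)
  open import Data.Sum.Base using (inj₁; inj₂)
  open import Function.Base using (_∘_)
  open import Relation.Binary.PropositionalEquality as ≡ using (_≡_)
  open PartitionStatistics
  open CommutativeSemiring R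
  open import Algebra.Properties.Semiring.Sum semiring
    using (sum-syntax; sum⁺-syntax; sum-cong-≋; sum-cong-≗; sum-init-last; ∑-comm; ∑-distrib-+; *-distribˡ-sum)
  open import Relation.Binary.Reasoning.Setoid setoid

  Σ-list-++ : {A : Set} (f : A → Carrier) (xs ys : List A) → Σ-list R f (xs ++ ys) ≈ Σ-list R f xs + Σ-list R f ys
  Σ-list-++ f []       ys = sym (+-identityˡ _)
  Σ-list-++ f (x ∷ xs) ys = trans (+-congˡ (Σ-list-++ f xs ys)) (sym (+-assoc _ _ _))

  Σ-list-concatMap : {A B : Set} (f : B → Carrier) (g : A → List B) (xs : List A) →
                     Σ-list R f (concatMap g xs) ≈ Σ-list R (λ x → Σ-list R f (g x)) xs
  Σ-list-concatMap f g []       = refl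
  Σ-list-concatMap f g (x ∷ xs) = trans (Σ-list-++ f (g x) (concatMap g xs)) (+-congˡ (Σ-list-concatMap f g xs))

  Σ-list-map : {A B : Set} (f : B → Carrier) (g : A → B) (xs : List A) →
               Σ-list R f (map g xs) ≡ Σ-list R (f ∘ g) xs
  Σ-list-map f g = foldr-map (λ x acc → f x + acc) g 0#

  Σ-list-tabulate : ∀ n {B : Set} (f : B → Carrier) (g : Fin n → B) →
                    Σ-list R f (tabulate g) ≡ ∑[ i < n ] f (g i)
  Σ-list-tabulate zero    f g = ≡.refl
  Σ-list-tabulate (suc n) f g = ≡.cong (f (g Fin.zero) +_) (Σ-list-tabulate n f (g ∘ Fin.suc))

  ∑-last : ∀ n (g : ℕ → Carrier) → ∑[ i ≤ n ] g (toℕ i) ≈ ∑[ i < n ] g (toℕ i) + g n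
  ∑-last n g = trans (sum-init-last {n} (g ∘ toℕ))
                     (+-cong (reflexive (sum-cong-≗ {n} (≡.cong g ∘ toℕ-inject₁)))
                             (reflexive (≡.cong g (toℕ-fromℕ n))))

  ∑-truncate : ∀ {x b} → x ≤ b → (g : ℕ → Carrier) →
               ∑[ y ≤ b ] (if toℕ y ≤ᵇ x then g (toℕ y) else 0#) ≈ ∑[ y ≤ x ] g (toℕ y)
  ∑-truncate {x} {b} x≤b g with m≤n⇒m<n∨m≡n x≤b
  ... | inj₂ ≡.refl = sum-cong-≋ {suc x} (λ y →
    reflexive (≡.cong (λ keep → if keep then g (toℕ y) else 0#) (≤ᵇ-true (toℕ≤pred[n] y))))
  ... | inj₁ (s≤s {n = b′} x≤b′) = begin
    ∑[ y ≤ suc b′ ] H (toℕ y)      ≈⟨ ∑-last (suc b′) H ⟩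
    ∑[ y ≤ b′ ] H (toℕ y) + H (suc b′) ≈⟨ +-congˡ (reflexive (≡.cong (λ keep → if keep then g (suc b′) else 0#)
                                                                    (≤ᵇ-false (s≤s x≤b′)))) ⟩
    ∑[ y ≤ b′ ] H (toℕ y) + 0#      ≈⟨ +-identityʳ _ ⟩
    ∑[ y ≤ b′ ] H (toℕ y)           ≈⟨ ∑-truncate x≤b′ g ⟩
    ∑[ y ≤ x ] g (toℕ y)            ∎
    where
    H : ℕ → Carrier
    H y = if y ≤ᵇ x then g y else 0#

  ∑Decreasing : ℕ → ℕ → (List ℕ → Carrier) → Carrier
  ∑Decreasing zero    b f = f []
  ∑Decreasing (suc n) b f = ∑[ x ≤ b ] ∑Decreasing n (toℕ x) (λ μ → f (toℕ x ∷ μ))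

  ∑Decreasing-cong : ∀ n b {f g : List ℕ → Carrier} →
                     (∀ μ → Linked _≥_ (b ∷ μ) → length μ ≡ n → f μ ≈ g μ) →
                     ∑Decreasing n b f ≈ ∑Decreasing n b g
  ∑Decreasing-cong zero    b f≈g = f≈g [] [-] ≡.refl
  ∑Decreasing-cong (suc n) b f≈g = sum-cong-≋ {suc b} (λ x →
    ∑Decreasing-cong n (toℕ x) (λ μ μ↓ len →
      f≈g (toℕ x ∷ μ) (toℕ≤pred[n] x ∷ μ↓) (≡.cong suc len)))

  *-distribˡ-∑Decreasing : ∀ n b k (f : List ℕ → Carrier) →
                           k * ∑Decreasing n b f ≈ ∑Decreasing n b (λ μ → k * f μ)
  *-distribˡ-∑Decreasing zero    b k f = refl
  *-distribˡ-∑Decreasing (suc n) b k f =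
    trans (*-distribˡ-sum {suc b} k (λ x → ∑Decreasing n (toℕ x) (λ μ → f (toℕ x ∷ μ))))
          (sum-cong-≋ {suc b} (λ x → *-distribˡ-∑Decreasing n (toℕ x) k (λ μ → f (toℕ x ∷ μ))))

  ∑Decreasing-zero-bound : ∀ n (f : List ℕ → Carrier) → ∑Decreasing n 0 f ≈ f (zeros n)
  ∑Decreasing-zero-bound zero    f = refl
  ∑Decreasing-zero-bound (suc n) f = trans (+-identityʳ _) (∑Decreasing-zero-bound n (λ μ → f (0 ∷ μ)))

  Σ-list-filter-sequences : ∀ (p : List ℕ → Bool) (f : List ℕ → Carrier) m k →
    Σ-list R f (filterᵇ p (sequences (suc m) k)) ≈
    ∑[ y < k ] Σ-list R (λ μ → f (toℕ y ∷ μ)) (filterᵇ (λ μ → p (toℕ y ∷ μ)) (sequences m k))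
  Σ-list-filter-sequences p f m k = begin
    Σ-list R f (filterᵇ p (sequences (suc m) k))
      ≡⟨ ≡.cong (Σ-list R f ∘ filterᵇ p) (sequences-suc m k) ⟩
    Σ-list R f (filterᵇ p (concatMap rows (allFin k)))
      ≡⟨ ≡.cong (Σ-list R f) (filterᵇ-concatMap p rows (allFin k)) ⟩
    Σ-list R f (concatMap (filterᵇ p ∘ rows) (allFin k))
      ≈⟨ Σ-list-concatMap f (filterᵇ p ∘ rows) (allFin k) ⟩
    Σ-list R (λ y → Σ-list R f (filterᵇ p (rows y))) (allFin k)
      ≡⟨ Σ-list-tabulate k (λ y → Σ-list R f (filterᵇ p (rows y))) (λ y → y) ⟩
    ∑[ y < k ] Σ-list R f (filterᵇ p (rows y))
      ≡⟨ sum-cong-≗ {k} (λ y → ≡.trans (≡.cong (Σ-list R f) (filterᵇ-map p (toℕ y ∷_) (sequences m k)))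
                                          (Σ-list-map f (toℕ y ∷_) (filterᵇ (p ∘ (toℕ y ∷_)) (sequences m k)))) ⟩
    ∑[ y < k ] Σ-list R (λ μ → f (toℕ y ∷ μ)) (filterᵇ (λ μ → p (toℕ y ∷ μ)) (sequences m k)) ∎
    where
    rows : Fin k → List (List ℕ)
    rows y = map (toℕ y ∷_) (sequences m k)

  Σ-list-decreasing-below : ∀ n {x b} → x ≤ b → (f : List ℕ → Carrier) →
    Σ-list R f (filterᵇ (λ μ → decreasingᵇ (x ∷ μ)) (sequences n (suc b))) ≈ ∑Decreasing n x f
  Σ-list-decreasing-below zero    x≤b f = +-identityʳ (f [])
  Σ-list-decreasing-below (suc m) {x} {b} x≤b f = begin
    Σ-list R f (filterᵇ (λ μ → decreasingᵇ (x ∷ μ)) (sequences (suc m) (suc b)))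
      ≈⟨ Σ-list-filter-sequences (λ μ → decreasingᵇ (x ∷ μ)) f m (suc b) ⟩
    ∑[ y ≤ b ] Σ-list R (λ μ → f (toℕ y ∷ μ))
                        (filterᵇ (λ μ → (toℕ y ≤ᵇ x) ∧ decreasingᵇ (toℕ y ∷ μ)) (sequences m (suc b)))
      ≈⟨ sum-cong-≋ {suc b} (λ y → below (toℕ y) (toℕ≤pred[n] y)) ⟩
    ∑[ y ≤ b ] (if toℕ y ≤ᵇ x then ∑Decreasing m (toℕ y) (λ μ → f (toℕ y ∷ μ)) else 0#)
      ≈⟨ ∑-truncate x≤b (λ y → ∑Decreasing m y (λ μ → f (y ∷ μ))) ⟩
    ∑Decreasing (suc m) x f ∎
    where
    below : ∀ y → y ≤ b →
      Σ-list R (λ μ → f (y ∷ μ)) (filterᵇ (λ μ → (y ≤ᵇ x) ∧ decreasingᵇ (y ∷ μ)) (sequences m (suc b)))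
      ≈ (if y ≤ᵇ x then ∑Decreasing m y (λ μ → f (y ∷ μ)) else 0#)
    below y y≤b with y ≤ᵇ x
    ... | true  = Σ-list-decreasing-below m y≤b (λ μ → f (y ∷ μ))
    ... | false = reflexive (≡.cong (Σ-list R (λ μ → f (y ∷ μ))) (filterᵇ-false (sequences m (suc b))))

  Σ-list-P : ∀ n b (f : List ℕ → Carrier) → Σ-list R f (P n b) ≈ ∑Decreasing n b f
  Σ-list-P zero    b f = +-identityʳ (f [])
  Σ-list-P (suc m) b f = trans (Σ-list-filter-sequences decreasingᵇ f m (suc b))
    (sum-cong-≋ {suc b} (λ y → Σ-list-decreasing-below m (toℕ≤pred[n] y) (λ μ → f (toℕ y ∷ μ))))

  ∑Decreasing-hooks : ∀ n b (f : List ℕ → Carrier) →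
    ∑Decreasing n b f ≈
    f (zeros n) + ∑[ r < n ] ∑[ c < b ] ∑Decreasing (toℕ r) (toℕ c)
                                          (λ μ → f (hook (toℕ c) μ ++ zeros (n ∸ suc (toℕ r))))
  ∑Decreasing-hooks zero    b f = sym (+-identityʳ (f []))
  ∑Decreasing-hooks (suc m) b f = begin
    ∑Decreasing m 0 (λ μ → f (0 ∷ μ))
      + ∑[ c < b ] ∑Decreasing m (suc (toℕ c)) (λ μ → f (suc (toℕ c) ∷ μ))
      ≈⟨ +-cong (∑Decreasing-zero-bound m (λ μ → f (0 ∷ μ)))
                (sum-cong-≋ {b} (λ c → ∑Decreasing-hooks m (suc (toℕ c)) (λ μ → f (suc (toℕ c) ∷ μ)))) ⟩
    f (zeros (suc m)) + ∑[ c < b ] (single c + ∑[ r < m ] longer c r)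
      ≈⟨ +-congˡ (∑-distrib-+ {b} single (λ c → ∑[ r < m ] longer c r)) ⟩
    f (zeros (suc m)) + (∑[ c < b ] single c + ∑[ c < b ] ∑[ r < m ] longer c r)
      ≈⟨ +-congˡ (+-congˡ (∑-comm {b} {m} longer)) ⟩
    f (zeros (suc m)) + (∑[ c < b ] single c + ∑[ r < m ] ∑[ c < b ] longer c r) ∎
    where
    single : Fin b → Carrier
    single c = f (suc (toℕ c) ∷ zeros m)
    longer : Fin b → Fin m → Carrier
    longer c r = ∑[ c′ ≤ toℕ c ] ∑Decreasing (toℕ r) (toℕ c′)
                   (λ μ → f (suc (toℕ c) ∷ hook (toℕ c′) μ ++ zeros (m ∸ suc (toℕ r))))

  -- expand (suc c) is a bijection from P(n,c) onto {hook c ν : ν ∈ P(n,c)}, stated as an equality of sums.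
  ∑Decreasing-expand : ∀ n c (f : List ℕ → Carrier) →
    ∑Decreasing n c (λ μ → f (expand (suc c) μ)) ≈ ∑Decreasing n c (λ ν → f (hook c ν))
  ∑Decreasing-expand zero          c f = refl
  ∑Decreasing-expand (suc zero)    c f = begin
    f (suc c ∷ suc c ∷ []) + ∑[ y < c ] f (hook c (toℕ y ∷ []))
      ≈⟨ +-comm _ _ ⟩
    ∑[ y < c ] f (hook c (toℕ y ∷ [])) + f (suc c ∷ suc c ∷ [])
      ≈⟨ ∑-last c (λ y → f (hook c (y ∷ []))) ⟨
    ∑[ y ≤ c ] f (hook c (toℕ y ∷ [])) ∎
  ∑Decreasing-expand (suc (suc m)) c f = begin
    ∑Decreasing (suc m) 0 W + ∑[ y < c ] ∑Decreasing (suc m) (suc (toℕ y)) (G (suc (toℕ y)))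
      ≈⟨ +-congˡ (sum-cong-≋ {c} (λ y → split (toℕ y))) ⟩
    ∑Decreasing (suc m) 0 W + ∑[ y < c ] (cornerFirst (toℕ y) + flatFirst (toℕ y))
      ≈⟨ +-congˡ (∑-distrib-+ {c} (cornerFirst ∘ toℕ) (flatFirst ∘ toℕ)) ⟩
    ∑Decreasing (suc m) 0 W + (∑[ y < c ] cornerFirst (toℕ y) + ∑[ y < c ] flatFirst (toℕ y))
      ≈⟨ regroup (∑Decreasing m 0 (λ μ → W (0 ∷ μ))) _ _ ⟩
    ∑Decreasing (suc m) c W + ∑[ y < c ] cornerFirst (toℕ y)
      ≈⟨ +-cong (∑Decreasing-expand (suc m) c (λ μ → f (suc c ∷ μ)))
                (sum-cong-≋ {c} (λ y → ∑Decreasing-expand (suc m) (toℕ y) (λ μ → f (suc c ∷ μ)))) ⟩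
    H c + ∑[ y < c ] H (toℕ y)
      ≈⟨ +-comm _ _ ⟩
    ∑[ y < c ] H (toℕ y) + H c
      ≈⟨ ∑-last c H ⟨
    ∑Decreasing (suc (suc m)) c (λ ν → f (hook c ν)) ∎
    where
    G : ℕ → List ℕ → Carrier
    G y μ = f (expand (suc c) (y ∷ μ))
    W : List ℕ → Carrier
    W μ = f (suc c ∷ expand (suc c) μ)
    H : ℕ → Carrier
    H y = ∑Decreasing (suc m) y (λ ν → f (suc c ∷ hook y ν))
    cornerFirst : ℕ → Carrier
    cornerFirst y = ∑Decreasing (suc m) y (λ μ → f (suc c ∷ expand (suc y) μ))
    flatFirst : ℕ → Carrier
    flatFirst y = ∑Decreasing m (suc y) (λ μ → W (suc y ∷ μ))
    split : ∀ y → ∑Decreasing (suc m) (suc y) (G (suc y)) ≈ cornerFirst y + flatFirst y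
    split y = trans (∑-last (suc y) (λ z → ∑Decreasing m z (λ μ → G (suc y) (z ∷ μ))))
      (+-cong (∑Decreasing-cong (suc m) y (λ μ μ↓ _ →
                 reflexive (≡.cong (λ b → f (suc c ∷ expand (if b then suc y else suc c) μ))
                                    (isCornerRow-< (suc y) μ (s≤s (head-≤ μ↓))))))
              (∑Decreasing-cong m (suc y) (λ μ _ _ →
                 reflexive (≡.cong (λ b → f (suc c ∷ expand (if b then suc y else suc c) (suc y ∷ μ)))
                                    (isCornerRow-≥ (suc y) (suc y ∷ μ) ≤-refl)))))
    regroup : ∀ w a b → (w + 0#) + (a + b) ≈ (w + b) + a
    regroup w a b = trans (+-cong (+-identityʳ w) (+-comm a b)) (sym (+-assoc w b a))

  HookRecursion : (K F : ℕ → ℕ → Carrier) → Set ℓ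
  HookRecursion K F = ∀ n b → F n b ≈ 1# + ∑[ r < n ] ∑[ c < b ] (K (toℕ r) (toℕ c) * F (toℕ r) (toℕ c))

  HookRecursion-unique : ∀ {K F G} → HookRecursion K F → HookRecursion K G → ∀ n b → F n b ≈ G n b
  HookRecursion-unique {K} {F} {G} recF recG = <-rec (λ n → ∀ b → F n b ≈ G n b) step
    where
    step : ∀ n → (∀ {m} → m < n → ∀ b → F m b ≈ G m b) → ∀ b → F n b ≈ G n b
    step n F≈G b = begin
      F n b
        ≈⟨ recF n b ⟩
      1# + ∑[ r < n ] ∑[ c < b ] (K (toℕ r) (toℕ c) * F (toℕ r) (toℕ c))
        ≈⟨ +-congˡ (sum-cong-≋ {n} (λ r → sum-cong-≋ {b} (λ c → *-congˡ (F≈G (toℕ<n r) (toℕ c))))) ⟩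
      1# + ∑[ r < n ] ∑[ c < b ] (K (toℕ r) (toℕ c) * G (toℕ r) (toℕ c))
        ≈⟨ recG n b ⟨
      G n b ∎

  ∑Decreasing-hookRecursion : ∀ K (w : List ℕ → Carrier) → (∀ n → w (zeros n) ≈ 1#) →
    (∀ r c k → ∑Decreasing r c (λ μ → w (hook c μ ++ zeros k)) ≈ K r c * ∑Decreasing r c w) →
    HookRecursion K (λ n b → ∑Decreasing n b w)
  ∑Decreasing-hookRecursion K w empty hooks n b = trans (∑Decreasing-hooks n b w)
    (+-cong (empty n) (sum-cong-≋ {n} (λ r → sum-cong-≋ {b} (λ c →
      hooks (toℕ r) (toℕ c) (n ∸ suc (toℕ r))))))

  module Weights (q t : Carrier) where
    open RS rawSemiring using (_^_)
    open import Algebra.Properties.Semiring.Exp semiring using (^-homo-*)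
    open import Algebra.Properties.CommutativeSemigroup *-commutativeSemigroup using (interchange)

    durfeeWeight : List ℕ → Carrier
    durfeeWeight lm = q ^ area lm * t ^ durfee lm

    cornerWeight : List ℕ → Carrier
    cornerWeight lm = q ^ cohookArea lm * t ^ cor lm

    hookFactor : ℕ → ℕ → Carrier
    hookFactor r c = q ^ (suc c ℕ.+ r) * t

    monomial-shift : ∀ a m k → q ^ (a ℕ.+ m) * t ^ suc k ≈ (q ^ a * t) * (q ^ m * t ^ k)
    monomial-shift a m k = trans (*-congʳ (^-homo-* q a m)) (interchange (q ^ a) (q ^ m) t (t ^ k))

    durfeeWeight-hook : ∀ c μ k → durfeeWeight (hook c μ ++ zeros k) ≈ hookFactor (length μ) c * durfeeWeight μ
    durfeeWeight-hook c μ k = trans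
      (reflexive (≡.cong₂ (λ m d → q ^ m * t ^ d) (≡.trans (area-++-zeros (hook c μ) k) (area-hook c μ))
                                                  (≡.trans (durfee-++-zeros (hook c μ) k) (durfee-hook c μ))))
      (monomial-shift (suc c ℕ.+ length μ) (area μ) (durfee μ))

    cornerWeight-expand : ∀ {c μ} → Linked _≥_ (c ∷ μ) → ∀ k →
                          cornerWeight (expand (suc c) μ ++ zeros k) ≈ hookFactor (length μ) c * cornerWeight μ
    cornerWeight-expand {c} {μ} μ↓ k = trans
      (reflexive (≡.cong₂ (λ m d → q ^ m * t ^ d)
                          (≡.trans (cohookArea-++-zeros (expand (suc c) μ) k) (cohookArea-expand μ↓))
                          (≡.trans (cor-++-zeros (expand (suc c) μ) k) (cor-expand μ↓))))
      (monomial-shift (suc c ℕ.+ length μ) (cohookArea μ) (cor μ))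

    durfee-hookRecursion : HookRecursion hookFactor (λ n b → ∑Decreasing n b durfeeWeight)
    durfee-hookRecursion = ∑Decreasing-hookRecursion hookFactor durfeeWeight empty hooks
      where
      empty : ∀ n → durfeeWeight (zeros n) ≈ 1#
      empty n = trans (reflexive (≡.cong₂ (λ m d → q ^ m * t ^ d) (area-++-zeros [] n) (durfee-++-zeros [] n)))
                      (*-identityˡ 1#)
      hooks : ∀ r c k → ∑Decreasing r c (λ μ → durfeeWeight (hook c μ ++ zeros k))
                        ≈ hookFactor r c * ∑Decreasing r c durfeeWeight
      hooks r c k = trans
        (∑Decreasing-cong r c (λ μ _ len →
           trans (durfeeWeight-hook c μ k) (reflexive (≡.cong (λ l → hookFactor l c * durfeeWeight μ) len))))
        (sym (*-distribˡ-∑Decreasing r c (hookFactor r c) durfeeWeight))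

    corner-hookRecursion : HookRecursion hookFactor (λ n b → ∑Decreasing n b cornerWeight)
    corner-hookRecursion = ∑Decreasing-hookRecursion hookFactor cornerWeight empty hooks
      where
      empty : ∀ n → cornerWeight (zeros n) ≈ 1#
      empty n = trans (reflexive (≡.cong₂ (λ m d → q ^ m * t ^ d) (cohookArea-++-zeros [] n) (cor-++-zeros [] n)))
                      (*-identityˡ 1#)
      hooks : ∀ r c k → ∑Decreasing r c (λ μ → cornerWeight (hook c μ ++ zeros k))
                        ≈ hookFactor r c * ∑Decreasing r c cornerWeight
      hooks r c k = begin
        ∑Decreasing r c (λ μ → cornerWeight (hook c μ ++ zeros k))
          ≈⟨ ∑Decreasing-expand r c (λ l → cornerWeight (l ++ zeros k)) ⟨
        ∑Decreasing r c (λ μ → cornerWeight (expand (suc c) μ ++ zeros k))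
          ≈⟨ ∑Decreasing-cong r c (λ μ μ↓ len → trans (cornerWeight-expand μ↓ k)
               (reflexive (≡.cong (λ l → hookFactor l c * cornerWeight μ) len))) ⟩
        ∑Decreasing r c (λ μ → hookFactor r c * cornerWeight μ)
          ≈⟨ *-distribˡ-∑Decreasing r c (hookFactor r c) cornerWeight ⟨
        hookFactor r c * ∑Decreasing r c cornerWeight ∎

theorem1p2 : {c ℓ : Level} (R : CommutativeSemiring c ℓ) (a b : ℕ) → a ≥ 1 → b ≥ 1 →
    (q t : CommutativeSemiring.Carrier R) →
    let open CommutativeSemiring R
        open RS rawSemiring using (_^_)
    in Σ-list R (λ lm → (q ^ area lm) * (t ^ durfee lm)) (P a b)
       ≈ Σ-list R (λ lm → (q ^ cohookArea lm) * (t ^ cor lm)) (P a b)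
-- The identity holds for all a and b.
theorem1p2 R a b _ _ q t = begin
  Σ-list R durfeeWeight (P a b)
    ≈⟨ Σ-list-P a b durfeeWeight ⟩
  ∑Decreasing a b durfeeWeight
    ≈⟨ HookRecursion-unique {hookFactor} durfee-hookRecursion corner-hookRecursion a b ⟩
  ∑Decreasing a b cornerWeight
    ≈⟨ Σ-list-P a b cornerWeight ⟨
  Σ-list R cornerWeight (P a b) ∎
  where
  open GeneratingFunctions R
  open Weights q t
  open SetoidReasoning (CommutativeSemiring.setoid R)
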